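{- Let $a,b\geq 2$ be integers and let $S_{a,b}$ be the double star. If $a\geq 3$ and $b\geq 3$, then $\chi_{md}(S_{a,b})=3$; otherwise $\chi_{md}(S_{a,b})=2$.
   Context: The double star $S_{a,b}$ (for $a,b\geq 2$) has two adjacent central vertices $u$ and $v$ with $d(u)=a$ and $d(v)=b$: $u$ is adjacent to $v$ and to $a-1$ pendant vertices $x_1,\dots,x_{a-1}$, and $v$ is adjacent to $u$ and to $b-1$ pendant vertices $y_1,\dots,y_{b-1}$. For a vertex $w$, $N[w]=N(w)\cup\{w\}$; $w$ dominates exactly the vertices of $N[w]$. A majority dominator coloring of $G$ is a proper vertex coloring such that for every vertex $w$ there is a color class $C$ with $|N[w]\cap C|\geq |C|/2$. $\chi_{md}(G)$ is the minimum number of color classes in a majority dominator coloring of $G$. -}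

module Defs where

open import Data.Nat using (ℕ; zero; suc; _+_; _*_; _∸_; _≤_; _<_; _≤ᵇ_; _≡ᵇ_)
open import Data.Bool using (Bool; true; false; _∧_; _∨_; if_then_else_)
open import Data.Fin using (Fin; toℕ)
import Data.Fin as Fin
open import Data.List using (List; length; filter; map)
open import Data.List.Base using (filterᵇ)
open import Data.Product using (Σ; _×_; ∃)
open import Relation.Nullary using (¬_; does)
open import Relation.Binary.PropositionalEquality using (_≡_)
open import Data.List using () renaming (allFin to allFinL)

record Graph : Set where
  field
    n   : ℕ
    adj : Fin n → Fin n → Bool
open Graph public

count : {n : ℕ} → (Fin n → Bool) → ℕ
count {n} p = length (filterᵇ p (allFinL n))

inClosedNbhd : (G : Graph) → Fin (n G) → Fin (n G) → Bool
inClosedNbhd G z w = does (z Fin.≟ w) ∨ adj G z w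

IsProper : (G : Graph) {k : ℕ} → (Fin (n G) → Fin k) → Set
IsProper G c = ∀ z w → adj G z w ≡ true → ¬ (c z ≡ c w)

classSize : (G : Graph) {k : ℕ} → (Fin (n G) → Fin k) → Fin k → ℕ
classSize G c i = count (λ w → does (c w Fin.≟ i))

nbhdClassSize : (G : Graph) {k : ℕ} → (Fin (n G) → Fin k) → Fin (n G) → Fin k → ℕ
nbhdClassSize G c z i = count (λ w → inClosedNbhd G z w ∧ does (c w Fin.≟ i))

IsMDColoring : (G : Graph) (k : ℕ) → (Fin (n G) → Fin k) → Set
IsMDColoring G k c =
  IsProper G c ×
  (∀ (i : Fin k) → ∃ λ w → c w ≡ i) ×
  (∀ (z : Fin (n G)) → ∃ λ (i : Fin k) → classSize G c i ≤ 2 * nbhdClassSize G c z i)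

HasMDColoring : (G : Graph) → ℕ → Set
HasMDColoring G k = ∃ λ (c : Fin (n G) → Fin k) → IsMDColoring G k c

χmd≡ : Graph → ℕ → Set
χmd≡ G k = HasMDColoring G k × (∀ m → m < k → ¬ HasMDColoring G m)

-- Double star S_{a,b} on vertex set {0,…,a+b-1}:
--   0 = u, 1 = v, 2..a = x_1..x_{a-1} (pendants at u),
--   a+1..a+b-1 = y_1..y_{b-1} (pendants at v).
dsEdge : ℕ → ℕ → ℕ → ℕ → Bool
dsEdge a b i j =
     ((i ≡ᵇ 0) ∧ (j ≡ᵇ 1))
  ∨ ((i ≡ᵇ 0) ∧ (2 ≤ᵇ j) ∧ (j ≤ᵇ a))
  ∨ ((i ≡ᵇ 1) ∧ (suc a ≤ᵇ j) ∧ (j ≤ᵇ (a + b ∸ 1)))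

doubleStar : ℕ → ℕ → Graph
doubleStar a b = record
  { n   = a + b
  ; adj = λ z w → dsEdge a b (toℕ z) (toℕ w) ∨ dsEdge a b (toℕ w) (toℕ z)
  }

module Submission where

-- Every vertex of S_{a,b} lies in N[u] or N[v], so giving u and v singleton colours and all leaves
-- a third colour is a majority dominator colouring, and the edge uv rules out fewer than two colours.
-- If a = 2, the bipartition class {v, x₁} of the unique proper 2-colouring has two vertices and meets
-- every closed neighbourhood (symmetrically {u, y₁} if b = 2). If a, b ≥ 3, both bipartition classes
-- have at least three vertices, while the closed neighbourhood {x₁, u} of a leaf meets each class in a
-- single vertex, so the majority condition fails at x₁.

open import Defs
open import Data.Nat using (ℕ; _≤_; _<_)
open import Data.Product using (_×_)
open import Data.Sum using (_⊎_)

open import Algebra.Properties.CommutativeSemigroup using (interchange)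
open import Data.Bool using (Bool; true; false; T; _∧_; _∨_)
open import Data.Bool.Properties using (T-≡; T-∧; T-∨)
open import Data.Empty using (⊥; ⊥-elim)
open import Data.Fin using (Fin; zero; suc; toℕ; fromℕ<; _≟_)
open import Data.Fin.Properties using (toℕ-injective; toℕ-fromℕ<; toℕ<n)
open import Data.List using (length; tabulate)
open import Data.List.Base using (filterᵇ)
open import Data.Nat using (zero; suc; _+_; _*_; _∸_; _≡ᵇ_; _≤?_; z≤n; s≤s)
open import Data.Nat.Properties
  using ( ≤-refl; ≤-reflexive; ≤-trans; ≤-antisym; ≤-pred; <⇒≤pred; <⇒≱; ≰⇒>; n≤0⇒n≡0; n<1+n
        ; n≤1+n; m≤m+n; m≤n+m; 1+n≢n; m<1+n⇒m<n∨m≡n; ≡ᵇ⇒≡; ≤ᵇ⇒≤; ≤⇒≤ᵇ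
        ; +-comm; +-identityʳ; +-mono-≤; +-monoʳ-≤; *-monoʳ-≤; +-commutativeSemigroup; module ≤-Reasoning )
open import Data.Product using (∃; _,_; proj₁; proj₂)
open import Data.Sum using (inj₁; inj₂)
import Data.Sum as Sum
open import Function using (_∘_; Equivalence)
open import Relation.Nullary using (¬_; Dec; yes; no; does; contradiction)
open import Relation.Binary.PropositionalEquality
open Equivalence using (to; from)

-- Counting

indicator : Bool → ℕ
indicator true  = 1
indicator false = 0

length-filterᵇ-tabulate : ∀ {A : Set} {n} (p : A → Bool) (f : Fin n → A) →
                          length (filterᵇ p (tabulate f)) ≡ count (p ∘ f)
length-filterᵇ-tabulate {n = zero}  p f = refl
length-filterᵇ-tabulate {n = suc n} p f with p (f zero)
... | true  = cong suc (trans (length-filterᵇ-tabulate p (f ∘ suc))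
                              (sym (length-filterᵇ-tabulate (p ∘ f) suc)))
... | false = trans (length-filterᵇ-tabulate p (f ∘ suc))
                    (sym (length-filterᵇ-tabulate (p ∘ f) suc))

count-suc : ∀ {n} (p : Fin (suc n) → Bool) → count p ≡ indicator (p zero) + count (p ∘ suc)
count-suc p with p zero
... | true  = cong suc (length-filterᵇ-tabulate p suc)
... | false = length-filterᵇ-tabulate p suc

count-false : ∀ {n} → count {n} (λ _ → false) ≡ 0
count-false {zero}  = refl
count-false {suc n} = trans (count-suc {n} (λ _ → false)) (count-false {n})

count-mono : ∀ {n} {p q : Fin n → Bool} → (∀ w → T (p w) → T (q w)) → count p ≤ count q
count-mono {zero}          p⇒q = z≤n
count-mono {suc n} {p} {q} p⇒q = begin
  count p                              ≡⟨ count-suc p ⟩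
  indicator (p zero) + count (p ∘ suc) ≤⟨ +-mono-≤ (indicator-mono (p⇒q zero)) (count-mono (p⇒q ∘ suc)) ⟩
  indicator (q zero) + count (q ∘ suc) ≡⟨ count-suc q ⟨
  count q                              ∎
  where
  open ≤-Reasoning
  indicator-mono : ∀ {x y} → (T x → T y) → indicator x ≤ indicator y
  indicator-mono {false}         _   = z≤n
  indicator-mono {true}  {true}  _   = ≤-refl
  indicator-mono {true}  {false} x⇒y = ⊥-elim (x⇒y _)

count-∨+count-∧ : ∀ {n} (p q : Fin n → Bool) →
                  count (λ w → p w ∨ q w) + count (λ w → p w ∧ q w) ≡ count p + count q
count-∨+count-∧ {zero}  p q = refl
count-∨+count-∧ {suc n} p q = begin
  count p∨q + count p∧q
    ≡⟨ cong₂ _+_ (count-suc p∨q) (count-suc p∧q) ⟩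
  (indicator (p∨q zero) + count (p∨q ∘ suc)) + (indicator (p∧q zero) + count (p∧q ∘ suc))
    ≡⟨ interchange +-commutativeSemigroup
         (indicator (p∨q zero)) (count (p∨q ∘ suc)) (indicator (p∧q zero)) (count (p∧q ∘ suc)) ⟩
  (indicator (p∨q zero) + indicator (p∧q zero)) + (count (p∨q ∘ suc) + count (p∧q ∘ suc))
    ≡⟨ cong₂ _+_ (indicator-∨+∧ (p zero) (q zero)) (count-∨+count-∧ (p ∘ suc) (q ∘ suc)) ⟩
  (indicator (p zero) + indicator (q zero)) + (count (p ∘ suc) + count (q ∘ suc))
    ≡⟨ interchange +-commutativeSemigroup
         (indicator (p zero)) (indicator (q zero)) (count (p ∘ suc)) (count (q ∘ suc)) ⟩
  (indicator (p zero) + count (p ∘ suc)) + (indicator (q zero) + count (q ∘ suc))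
    ≡⟨ cong₂ _+_ (count-suc p) (count-suc q) ⟨
  count p + count q
    ∎
  where
  open ≡-Reasoning
  p∨q p∧q : Fin (suc n) → Bool
  p∨q w = p w ∨ q w
  p∧q w = p w ∧ q w
  indicator-∨+∧ : ∀ x y → indicator (x ∨ y) + indicator (x ∧ y) ≡ indicator x + indicator y
  indicator-∨+∧ true  true  = refl
  indicator-∨+∧ true  false = refl
  indicator-∨+∧ false y     = +-identityʳ (indicator y)

count-∨-disjoint : ∀ {n} {p q : Fin n → Bool} → (∀ w → T (p w) → T (q w) → ⊥) →
                   count (λ w → p w ∨ q w) ≡ count p + count q
count-∨-disjoint {n} {p} {q} disjoint = begin
  count p∨q             ≡⟨ +-identityʳ (count p∨q) ⟨
  count p∨q + 0         ≡⟨ cong (count p∨q +_) count-p∧q≡0 ⟨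
  count p∨q + count p∧q ≡⟨ count-∨+count-∧ p q ⟩
  count p + count q     ∎
  where
  open ≡-Reasoning
  p∨q p∧q : Fin n → Bool
  p∨q w = p w ∨ q w
  p∧q w = p w ∧ q w
  count-p∧q≡0 : count p∧q ≡ 0
  count-p∧q≡0 = n≤0⇒n≡0 (subst (count p∧q ≤_) (count-false {n})
    (count-mono λ w pq → disjoint w (proj₁ (T-∧ .to pq)) (proj₂ (T-∧ .to pq))))

⁅_⁆ : ∀ {n} → Fin n → Fin n → Bool
⁅ x ⁆ w = does (w ≟ x)

⁅⁆⇒≡ : ∀ {n} (x w : Fin n) → T (⁅ x ⁆ w) → w ≡ x
⁅⁆⇒≡ x w with w ≟ x
... | yes w≡x = λ _ → w≡x
... | no  _   = λ ()

≡⇒⁅⁆ : ∀ {n} (x w : Fin n) → w ≡ x → T (⁅ x ⁆ w)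
≡⇒⁅⁆ x w w≡x with w ≟ x
... | yes _   = _
... | no  w≢x = w≢x w≡x

count-⁅⁆ : ∀ {n} (x : Fin n) → count ⁅ x ⁆ ≡ 1
count-⁅⁆ {suc n} zero    = trans (count-suc {n} ⁅ zero ⁆) (cong suc (count-false {n}))
count-⁅⁆ {suc n} (suc x) = trans (count-suc {n} ⁅ suc x ⁆) (count-⁅⁆ x)

1≤count : ∀ {n} {p : Fin n → Bool} {x} → T (p x) → 1 ≤ count p
1≤count {p = p} {x} px = subst (_≤ count p) (count-⁅⁆ x)
  (count-mono λ w w≡x → subst (T ∘ p) (sym (⁅⁆⇒≡ x w w≡x)) px)

count≤1 : ∀ {n} {p : Fin n → Bool} {x} → (∀ w → T (p w) → w ≡ x) → count p ≤ 1
count≤1 {p = p} {x} p⊆x = subst (count p ≤_) (count-⁅⁆ x)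
  (count-mono λ w pw → ≡⇒⁅⁆ x w (p⊆x w pw))

count≤2 : ∀ {n} {p : Fin n → Bool} {x y} → (∀ w → T (p w) → w ≡ x ⊎ w ≡ y) → count p ≤ 2
count≤2 {p = p} {x} {y} p⊆xy = begin
  count p                              ≤⟨ count-mono p⇒x∨y ⟩
  count x∨y                            ≤⟨ m≤m+n (count x∨y) _ ⟩
  count x∨y + count (λ w → ⁅ x ⁆ w ∧ ⁅ y ⁆ w) ≡⟨ count-∨+count-∧ ⁅ x ⁆ ⁅ y ⁆ ⟩
  count ⁅ x ⁆ + count ⁅ y ⁆            ≡⟨ cong₂ _+_ (count-⁅⁆ x) (count-⁅⁆ y) ⟩
  2                                    ∎
  where
  open ≤-Reasoning
  x∨y : _ → Bool
  x∨y w = ⁅ x ⁆ w ∨ ⁅ y ⁆ w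
  p⇒x∨y : ∀ w → T (p w) → T (x∨y w)
  p⇒x∨y w pw = T-∨ .from (Sum.map (≡⇒⁅⁆ x w) (≡⇒⁅⁆ y w) (p⊆xy w pw))

3≤count : ∀ {n} {p : Fin n → Bool} {x y z} → x ≢ y → x ≢ z → y ≢ z →
          T (p x) → T (p y) → T (p z) → 3 ≤ count p
3≤count {p = p} {x} {y} {z} x≢y x≢z y≢z px py pz = begin
  3                                           ≡⟨ cong₂ _+_ (count-⁅⁆ x) (cong₂ _+_ (count-⁅⁆ y) (count-⁅⁆ z)) ⟨
  count ⁅ x ⁆ + (count ⁅ y ⁆ + count ⁅ z ⁆)   ≡⟨ cong (count ⁅ x ⁆ +_) (count-∨-disjoint y-z) ⟨
  count ⁅ x ⁆ + count (λ w → ⁅ y ⁆ w ∨ ⁅ z ⁆ w) ≡⟨ count-∨-disjoint x-yz ⟨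
  count (λ w → ⁅ x ⁆ w ∨ (⁅ y ⁆ w ∨ ⁅ z ⁆ w))  ≤⟨ count-mono xyz⇒p ⟩
  count p                                     ∎
  where
  open ≤-Reasoning
  y-z : ∀ w → T (⁅ y ⁆ w) → T (⁅ z ⁆ w) → ⊥
  y-z w w≡y w≡z = y≢z (trans (sym (⁅⁆⇒≡ y w w≡y)) (⁅⁆⇒≡ z w w≡z))
  x-yz : ∀ w → T (⁅ x ⁆ w) → T (⁅ y ⁆ w ∨ ⁅ z ⁆ w) → ⊥
  x-yz w w≡x w∈yz with T-∨ .to w∈yz
  ... | inj₁ w≡y = x≢y (trans (sym (⁅⁆⇒≡ x w w≡x)) (⁅⁆⇒≡ y w w≡y))
  ... | inj₂ w≡z = x≢z (trans (sym (⁅⁆⇒≡ x w w≡x)) (⁅⁆⇒≡ z w w≡z))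
  xyz⇒p : ∀ w → T (⁅ x ⁆ w ∨ (⁅ y ⁆ w ∨ ⁅ z ⁆ w)) → T (p w)
  xyz⇒p w w∈xyz with T-∨ .to w∈xyz
  ... | inj₁ w≡x = subst (T ∘ p) (sym (⁅⁆⇒≡ x w w≡x)) px
  ... | inj₂ w∈yz with T-∨ .to w∈yz
  ...   | inj₁ w≡y = subst (T ∘ p) (sym (⁅⁆⇒≡ y w w≡y)) py
  ...   | inj₂ w≡z = subst (T ∘ p) (sym (⁅⁆⇒≡ z w w≡z)) pz

-- Colourings of an arbitrary graph

both-≢⇒≡ : ∀ {i j l : Fin 2} → i ≢ l → j ≢ l → i ≡ j
both-≢⇒≡ {zero}     {zero}                _   _   = refl
both-≢⇒≡ {suc zero} {suc zero}            _   _   = refl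
both-≢⇒≡ {zero}     {suc zero} {zero}     i≢l _   = ⊥-elim (i≢l refl)
both-≢⇒≡ {zero}     {suc zero} {suc zero} _   j≢l = ⊥-elim (j≢l refl)
both-≢⇒≡ {suc zero} {zero}     {zero}     _   j≢l = ⊥-elim (j≢l refl)
both-≢⇒≡ {suc zero} {zero}     {suc zero} i≢l _   = ⊥-elim (i≢l refl)

module _ (G : Graph) where

  ≡⇒inClosedNbhd : ∀ {z w} → z ≡ w → T (inClosedNbhd G z w)
  ≡⇒inClosedNbhd {z} refl = T-∨ .from (inj₁ (≡⇒⁅⁆ z z refl))

  adj⇒inClosedNbhd : ∀ z w → T (adj G z w) → T (inClosedNbhd G z w)
  adj⇒inClosedNbhd _ _ = T-∨ .from ∘ inj₂

  inClosedNbhd⇒≡⊎adj : ∀ {z w} → T (inClosedNbhd G z w) → z ≡ w ⊎ T (adj G z w)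
  inClosedNbhd⇒≡⊎adj {z} {w} = Sum.map₁ (⁅⁆⇒≡ w z) ∘ T-∨ .to

  proper⇒2≤colours : ∀ {k z w} (c : Fin (n G) → Fin k) → T (adj G z w) → IsProper G c → 2 ≤ k
  proper⇒2≤colours {zero} {z} c _ _ with c z
  ... | ()
  proper⇒2≤colours {suc zero} {z} {w} c zw proper =
    ⊥-elim (proper z w (T-≡ .to zw) (Fin1-≡ (c z) (c w)))
    where
    Fin1-≡ : (i j : Fin 1) → i ≡ j
    Fin1-≡ zero zero = refl
  proper⇒2≤colours {suc (suc k)} c _ _ = s≤s (s≤s z≤n)

  proper₂-common-neighbour : ∀ {z x y} (c : Fin (n G) → Fin 2) → IsProper G c →
                             T (adj G z x) → T (adj G z y) → c x ≡ c y
  proper₂-common-neighbour {z} {x} {y} c proper zx zy =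
    both-≢⇒≡ (proper z x (T-≡ .to zx) ∘ sym) (proper z y (T-≡ .to zy) ∘ sym)

  small-class⇒majority : ∀ {k} (c : Fin (n G) → Fin k) {i x y} z w →
                         (∀ v → c v ≡ i → v ≡ x ⊎ v ≡ y) → T (inClosedNbhd G z w) → c w ≡ i →
                         classSize G c i ≤ 2 * nbhdClassSize G c z i
  small-class⇒majority c {i} z w class⊆xy z~w cw≡i = begin
    classSize G c i           ≤⟨ count≤2 (λ v cv≡i → class⊆xy v (⁅⁆⇒≡ i (c v) cv≡i)) ⟩
    2                         ≤⟨ *-monoʳ-≤ 2 (1≤count {x = w} (T-∧ .from (z~w , ≡⇒⁅⁆ i (c w) cw≡i))) ⟩
    2 * nbhdClassSize G c z i ∎
    where open ≤-Reasoning

  nbhdClassSize-pendant : ∀ {k} (c : Fin (n G) → Fin k) {z p} i →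
                          (∀ w → T (inClosedNbhd G z w) → w ≡ z ⊎ w ≡ p) → c z ≢ c p →
                          nbhdClassSize G c z i ≤ 1
  nbhdClassSize-pendant c {z} {p} i N[z]⊆zp cz≢cp = by-colour-of-z (c z ≟ i)
    where
    member : ∀ w → T (inClosedNbhd G z w ∧ ⁅ i ⁆ (c w)) → (w ≡ z ⊎ w ≡ p) × c w ≡ i
    member w w∈ = N[z]⊆zp w (proj₁ (T-∧ .to w∈)) , ⁅⁆⇒≡ i (c w) (proj₂ (T-∧ .to w∈))
    by-colour-of-z : Dec (c z ≡ i) → nbhdClassSize G c z i ≤ 1
    by-colour-of-z (yes cz≡i) = count≤1 {x = z} λ w w∈ → case (member w w∈)
      where
      case : ∀ {w} → (w ≡ z ⊎ w ≡ p) × c w ≡ i → w ≡ z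
      case (inj₁ w≡z , _)    = w≡z
      case (inj₂ refl , cp≡i) = ⊥-elim (cz≢cp (trans cz≡i (sym cp≡i)))
    by-colour-of-z (no cz≢i) = count≤1 {x = p} λ w w∈ → case (member w w∈)
      where
      case : ∀ {w} → (w ≡ z ⊎ w ≡ p) × c w ≡ i → w ≡ p
      case (inj₁ refl , cz≡i) = ⊥-elim (cz≢i cz≡i)
      case (inj₂ w≡p , _)    = w≡p

-- Edges and vertex roles of the double star

data DSEdge (a b : ℕ) : ℕ → ℕ → Set where
  u-v : DSEdge a b 0 1
  u-x : ∀ {j} → 2 ≤ j → j ≤ a → DSEdge a b 0 j
  v-y : ∀ {j} → a < j → j ≤ a + b ∸ 1 → DSEdge a b 1 j

dsEdge⇒DSEdge : ∀ {a b} i j → T (dsEdge a b i j) → DSEdge a b i j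
dsEdge⇒DSEdge {a} {b} 0 j e with T-∨ .to e
... | inj₁ j≡1 = subst (DSEdge a b 0) (sym (≡ᵇ⇒≡ j 1 j≡1)) u-v
... | inj₂ e′ with T-∨ .to e′
...   | inj₁ x-range = u-x (≤ᵇ⇒≤ 2 j (proj₁ (T-∧ .to x-range))) (≤ᵇ⇒≤ j a (proj₂ (T-∧ .to x-range)))
dsEdge⇒DSEdge {a} {b} 1 j y-range =
  v-y (≤ᵇ⇒≤ (suc a) j (proj₁ (T-∧ .to y-range))) (≤ᵇ⇒≤ j (a + b ∸ 1) (proj₂ (T-∧ .to y-range)))

DSEdge⇒dsEdge : ∀ {a b i j} → DSEdge a b i j → T (dsEdge a b i j)
DSEdge⇒dsEdge u-v               = _
DSEdge⇒dsEdge {j = j} (u-x p q) =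
  T-∨ {x = j ≡ᵇ 1} .from (inj₂ (T-∨ .from (inj₁ (T-∧ .from (≤⇒≤ᵇ p , ≤⇒≤ᵇ q)))))
DSEdge⇒dsEdge (v-y p q)         = T-∧ .from (≤⇒≤ᵇ p , ≤⇒≤ᵇ q)

DSEdge-into-leaf-u : ∀ {a b i j} → 2 ≤ j → j ≤ a → DSEdge a b i j → i ≡ 0
DSEdge-into-leaf-u (s≤s (s≤s _)) _   (u-x _ _)   = refl
DSEdge-into-leaf-u (s≤s (s≤s _)) j≤a (v-y a<j _) = contradiction j≤a (<⇒≱ a<j)

¬DSEdge-from-leaf : ∀ {a b i j} → 2 ≤ i → ¬ DSEdge a b i j
¬DSEdge-from-leaf (s≤s (s≤s _)) ()

data Role : Set where
  centre-u centre-v leaf-u leaf-v : Role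

role : ℕ → ℕ → Role
role a 0 = centre-u
role a 1 = centre-v
role a (suc (suc k)) with suc (suc k) ≤? a
... | yes _ = leaf-u
... | no  _ = leaf-v

data RoleSpec (a k : ℕ) : Role → Set where
  centre-u : k ≡ 0 → RoleSpec a k centre-u
  centre-v : k ≡ 1 → RoleSpec a k centre-v
  leaf-u   : 2 ≤ k → k ≤ a → RoleSpec a k leaf-u
  leaf-v   : a < k → RoleSpec a k leaf-v

role-spec : ∀ a k → RoleSpec a k (role a k)
role-spec a 0 = centre-u refl
role-spec a 1 = centre-v refl
role-spec a (suc (suc k)) with suc (suc k) ≤? a
... | yes k≤a = leaf-u (s≤s (s≤s z≤n)) k≤a
... | no  k≰a = leaf-v (≰⇒> k≰a)

role-leaf-u : ∀ {a k} → 2 ≤ k → k ≤ a → role a k ≡ leaf-u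
role-leaf-u {a} {suc (suc k)} (s≤s (s≤s _)) k≤a with suc (suc k) ≤? a
... | yes _   = refl
... | no  k≰a = contradiction k≤a k≰a

role-leaf-v : ∀ {a k} → 2 ≤ k → a < k → role a k ≡ leaf-v
role-leaf-v {a} {suc (suc k)} (s≤s (s≤s _)) a<k with suc (suc k) ≤? a
... | yes k≤a = contradiction k≤a (<⇒≱ a<k)
... | no  _   = refl

data RoleEdge : Role → Role → Set where
  u-v : RoleEdge centre-u centre-v
  u-x : RoleEdge centre-u leaf-u
  v-y : RoleEdge centre-v leaf-v

DSEdge⇒RoleEdge : ∀ {a b i j} → 1 ≤ a → DSEdge a b i j → RoleEdge (role a i) (role a j)
DSEdge⇒RoleEdge _   u-v           = u-v
DSEdge⇒RoleEdge _   (u-x 2≤j j≤a) = subst (RoleEdge centre-u) (sym (role-leaf-u 2≤j j≤a)) u-x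
DSEdge⇒RoleEdge 1≤a (v-y a<j _)   =
  subst (RoleEdge centre-v) (sym (role-leaf-v (≤-trans (s≤s 1≤a) a<j) a<j)) v-y

module DoubleStar (a′ b′ : ℕ) where

  a b : ℕ
  a = 2 + a′
  b = 2 + b′

  S : Graph
  S = doubleStar a b

  V : Set
  V = Fin (a + b)

  vertex : ∀ k → k < a + b → V
  vertex k k<a+b = fromℕ< k<a+b

  toℕ-vertex : ∀ {k} (k<a+b : k < a + b) → toℕ (vertex k k<a+b) ≡ k
  toℕ-vertex k<a+b = toℕ-fromℕ< k<a+b

  distinct : ∀ {z w : V} {i j} → toℕ z ≡ i → toℕ w ≡ j → i ≢ j → z ≢ w
  distinct refl refl i≢j = i≢j ∘ cong toℕ

  2<a+b : 2 < a + b
  2<a+b = +-monoʳ-≤ 2 (≤-trans (s≤s z≤n) (m≤n+m b a′))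

  1+a<a+b : suc a < a + b
  1+a<a+b = subst (_≤ a + b) (+-comm a 2) (+-monoʳ-≤ a (m≤m+n 2 b′))

  u v x₁ y₁ : V
  u  = zero
  v  = suc zero
  x₁ = vertex 2 2<a+b
  y₁ = vertex (suc a) 1+a<a+b

  toℕ-x₁ : toℕ x₁ ≡ 2
  toℕ-x₁ = toℕ-vertex 2<a+b

  toℕ-y₁ : toℕ y₁ ≡ suc a
  toℕ-y₁ = toℕ-vertex 1+a<a+b

  adj⇒DSEdge : ∀ {z w} → T (adj S z w) → DSEdge a b (toℕ z) (toℕ w) ⊎ DSEdge a b (toℕ w) (toℕ z)
  adj⇒DSEdge = Sum.map (dsEdge⇒DSEdge _ _) (dsEdge⇒DSEdge _ _) ∘ T-∨ .to

  DSEdge⇒adj : ∀ {z w i j} → toℕ z ≡ i → toℕ w ≡ j → DSEdge a b i j → T (adj S z w)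
  DSEdge⇒adj refl refl = T-∨ .from ∘ inj₁ ∘ DSEdge⇒dsEdge

  adj-sym : ∀ {z w} → T (adj S z w) → T (adj S w z)
  adj-sym {z} {w} = T-∨ {x = dsEdge a b (toℕ w) (toℕ z)} .from ∘ Sum.swap ∘ T-∨ .to

  role-colouring-proper : ∀ {k} (col : Role → Fin k) →
                          (∀ {r s} → RoleEdge r s → col r ≢ col s) → IsProper S (col ∘ role a ∘ toℕ)
  role-colouring-proper col separates z w zw with adj⇒DSEdge {z} {w} (T-≡ .from zw)
  ... | inj₁ e = separates (DSEdge⇒RoleEdge (s≤s z≤n) e)
  ... | inj₂ e = separates (DSEdge⇒RoleEdge (s≤s z≤n) e) ∘ sym

  u~v : T (adj S u v)
  u~v = DSEdge⇒adj refl refl u-v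

  u~x₁ : T (adj S u x₁)
  u~x₁ = DSEdge⇒adj refl toℕ-x₁ (u-x ≤-refl (s≤s (s≤s z≤n)))

  v~y₁ : T (adj S v y₁)
  v~y₁ = DSEdge⇒adj refl toℕ-y₁ (v-y ≤-refl (<⇒≤pred 1+a<a+b))

  x~u : ∀ z → 2 ≤ toℕ z → toℕ z ≤ a → T (adj S z u)
  x~u z 2≤z z≤a = adj-sym {u} {z} (DSEdge⇒adj refl refl (u-x 2≤z z≤a))

  y~v : ∀ z → a < toℕ z → T (adj S z v)
  y~v z a<z = adj-sym {v} {z} (DSEdge⇒adj refl refl (v-y a<z (<⇒≤pred (toℕ<n z))))

  centres-dominate : ∀ z → T (inClosedNbhd S z u) ⊎ T (inClosedNbhd S z v)
  centres-dominate z with role a (toℕ z) | role-spec a (toℕ z)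
  ... | centre-u | centre-u z≡0   = inj₁ (≡⇒inClosedNbhd S (toℕ-injective z≡0))
  ... | centre-v | centre-v z≡1   = inj₂ (≡⇒inClosedNbhd S (toℕ-injective z≡1))
  ... | leaf-u   | leaf-u 2≤z z≤a = inj₁ (adj⇒inClosedNbhd S z u (x~u z 2≤z z≤a))
  ... | leaf-v   | leaf-v a<z     = inj₂ (adj⇒inClosedNbhd S z v (y~v z a<z))

  N[x₁]⊆x₁u : ∀ w → T (inClosedNbhd S x₁ w) → w ≡ x₁ ⊎ w ≡ u
  N[x₁]⊆x₁u w x₁~w with inClosedNbhd⇒≡⊎adj S x₁~w
  ... | inj₁ x₁≡w = inj₁ (sym x₁≡w)
  ... | inj₂ x₁~w′ with adj⇒DSEdge {x₁} {w} x₁~w′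
  ...   | inj₁ e = contradiction e (¬DSEdge-from-leaf (≤-reflexive (sym toℕ-x₁)))
  ...   | inj₂ e = inj₂ (toℕ-injective (DSEdge-into-leaf-u 2≤x₁ x₁≤a e))
    where
    2≤x₁ : 2 ≤ toℕ x₁
    2≤x₁ = ≤-reflexive (sym toℕ-x₁)
    x₁≤a : toℕ x₁ ≤ a
    x₁≤a = ≤-trans (≤-reflexive toℕ-x₁) (s≤s (s≤s z≤n))

  ¬hasMDColoring-<2 : ∀ {m} → m < 2 → ¬ HasMDColoring S m
  ¬hasMDColoring-<2 m<2 (c , proper , _) = <⇒≱ m<2 (proper⇒2≤colours S {z = u} {w = v} c u~v proper)

  proper⇒nbhdClassSize-x₁≤1 : ∀ {k} (c : V → Fin k) → IsProper S c → ∀ i → nbhdClassSize S c x₁ i ≤ 1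
  proper⇒nbhdClassSize-x₁≤1 c proper i =
    nbhdClassSize-pendant S c i N[x₁]⊆x₁u (proper u x₁ (T-≡ .to u~x₁) ∘ sym)

-- Upper bounds

threeColouring : Role → Fin 3
threeColouring centre-u = zero
threeColouring centre-v = suc zero
threeColouring leaf-u   = suc (suc zero)
threeColouring leaf-v   = suc (suc zero)

module _ (a′ b′ : ℕ) where
  open DoubleStar a′ b′

  hasMDColoring-3 : HasMDColoring S 3
  hasMDColoring-3 = c , role-colouring-proper threeColouring (λ { u-v () ; u-x () ; v-y () })
                      , onto , majority
    where
    c : V → Fin 3
    c = threeColouring ∘ role a ∘ toℕ
    onto : ∀ i → ∃ λ w → c w ≡ i
    onto zero             = u , refl
    onto (suc zero)       = v , refl
    onto (suc (suc zero)) = x₁ , cong threeColouring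
                                   (trans (cong (role a) toℕ-x₁) (role-leaf-u {a} ≤-refl (s≤s (s≤s z≤n))))
    class-u : ∀ w → threeColouring (role a (toℕ w)) ≡ zero → w ≡ u ⊎ w ≡ u
    class-u w with role a (toℕ w) | role-spec a (toℕ w)
    ... | centre-u | centre-u w≡0 = λ _ → inj₁ (toℕ-injective w≡0)
    ... | centre-v | _            = λ ()
    ... | leaf-u   | _            = λ ()
    ... | leaf-v   | _            = λ ()
    class-v : ∀ w → threeColouring (role a (toℕ w)) ≡ suc zero → w ≡ v ⊎ w ≡ v
    class-v w with role a (toℕ w) | role-spec a (toℕ w)
    ... | centre-u | _            = λ ()
    ... | centre-v | centre-v w≡1 = λ _ → inj₁ (toℕ-injective w≡1)
    ... | leaf-u   | _            = λ ()
    ... | leaf-v   | _            = λ ()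
    majority : ∀ z → ∃ λ i → classSize S c i ≤ 2 * nbhdClassSize S c z i
    majority z with centres-dominate z
    ... | inj₁ z~u = zero     , small-class⇒majority S c z u class-u z~u refl
    ... | inj₂ z~v = suc zero , small-class⇒majority S c z v class-v z~v refl

bipartition : Role → Fin 2
bipartition centre-u = zero
bipartition leaf-v   = zero
bipartition centre-v = suc zero
bipartition leaf-u   = suc zero

module _ (b′ : ℕ) where
  open DoubleStar 0 b′

  hasMDColoring-2-a≡2 : HasMDColoring S 2
  hasMDColoring-2-a≡2 = c , role-colouring-proper bipartition (λ { u-v () ; u-x () ; v-y () })
                          , onto , majority
    where
    c : V → Fin 2
    c = bipartition ∘ role a ∘ toℕ
    onto : ∀ i → ∃ λ w → c w ≡ i
    onto zero       = u , refl
    onto (suc zero) = v , refl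
    leaf-u≡x₁ : ∀ w → 2 ≤ toℕ w → toℕ w ≤ 2 → w ≡ x₁
    leaf-u≡x₁ w 2≤w w≤2 = toℕ-injective (trans (≤-antisym w≤2 2≤w) (sym toℕ-x₁))
    c-x₁ : c x₁ ≡ suc zero
    c-x₁ = cong bipartition (trans (cong (role a) toℕ-x₁) (role-leaf-u {a} ≤-refl ≤-refl))
    class-v : ∀ w → bipartition (role a (toℕ w)) ≡ suc zero → w ≡ v ⊎ w ≡ x₁
    class-v w with role a (toℕ w) | role-spec a (toℕ w)
    ... | centre-u | _              = λ ()
    ... | centre-v | centre-v w≡1   = λ _ → inj₁ (toℕ-injective w≡1)
    ... | leaf-u   | leaf-u 2≤w w≤2 = λ _ → inj₂ (leaf-u≡x₁ w 2≤w w≤2)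
    ... | leaf-v   | _              = λ ()
    dominated : ∀ z → T (inClosedNbhd S z v) ⊎ T (inClosedNbhd S z x₁)
    dominated z with role a (toℕ z) | role-spec a (toℕ z)
    ... | centre-u | centre-u z≡0   = inj₁ (adj⇒inClosedNbhd S z v (DSEdge⇒adj z≡0 refl u-v))
    ... | centre-v | centre-v z≡1   = inj₁ (≡⇒inClosedNbhd S (toℕ-injective z≡1))
    ... | leaf-u   | leaf-u 2≤z z≤2 = inj₂ (≡⇒inClosedNbhd S (leaf-u≡x₁ z 2≤z z≤2))
    ... | leaf-v   | leaf-v a<z     = inj₁ (adj⇒inClosedNbhd S z v (y~v z a<z))
    majority : ∀ z → ∃ λ i → classSize S c i ≤ 2 * nbhdClassSize S c z i
    majority z with dominated z
    ... | inj₁ z~v  = suc zero , small-class⇒majority S c z v  class-v z~v  refl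
    ... | inj₂ z~x₁ = suc zero , small-class⇒majority S c z x₁ class-v z~x₁ c-x₁

module _ (a′ : ℕ) where
  open DoubleStar a′ 0

  hasMDColoring-2-b≡2 : HasMDColoring S 2
  hasMDColoring-2-b≡2 = c , role-colouring-proper bipartition (λ { u-v () ; u-x () ; v-y () })
                          , onto , majority
    where
    c : V → Fin 2
    c = bipartition ∘ role a ∘ toℕ
    onto : ∀ i → ∃ λ w → c w ≡ i
    onto zero       = u , refl
    onto (suc zero) = v , refl
    leaf-v≡y₁ : ∀ w → a < toℕ w → w ≡ y₁
    leaf-v≡y₁ w a<w = toℕ-injective
      (trans (≤-antisym (≤-pred (subst (toℕ w <_) (+-comm a 2) (toℕ<n w))) a<w) (sym toℕ-y₁))
    c-y₁ : c y₁ ≡ zero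
    c-y₁ = cong bipartition (trans (cong (role a) toℕ-y₁) (role-leaf-v {a} (s≤s (s≤s z≤n)) ≤-refl))
    class-u : ∀ w → bipartition (role a (toℕ w)) ≡ zero → w ≡ u ⊎ w ≡ y₁
    class-u w with role a (toℕ w) | role-spec a (toℕ w)
    ... | centre-u | centre-u w≡0 = λ _ → inj₁ (toℕ-injective w≡0)
    ... | centre-v | _            = λ ()
    ... | leaf-u   | _            = λ ()
    ... | leaf-v   | leaf-v a<w   = λ _ → inj₂ (leaf-v≡y₁ w a<w)
    dominated : ∀ z → T (inClosedNbhd S z u) ⊎ T (inClosedNbhd S z y₁)
    dominated z with role a (toℕ z) | role-spec a (toℕ z)
    ... | centre-u | centre-u z≡0   = inj₁ (≡⇒inClosedNbhd S (toℕ-injective z≡0))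
    ... | centre-v | centre-v z≡1   = inj₁ (adj⇒inClosedNbhd S z u (adj-sym {u} {z} (DSEdge⇒adj refl z≡1 u-v)))
    ... | leaf-u   | leaf-u 2≤z z≤a = inj₁ (adj⇒inClosedNbhd S z u (x~u z 2≤z z≤a))
    ... | leaf-v   | leaf-v a<z     = inj₂ (≡⇒inClosedNbhd S (leaf-v≡y₁ z a<z))
    majority : ∀ z → ∃ λ i → classSize S c i ≤ 2 * nbhdClassSize S c z i
    majority z with dominated z
    ... | inj₁ z~u  = zero , small-class⇒majority S c z u  class-u z~u  refl
    ... | inj₂ z~y₁ = zero , small-class⇒majority S c z y₁ class-u z~y₁ c-y₁

-- No majority dominator 2-colouring when a, b ≥ 3

module _ (a″ b″ : ℕ) where
  open DoubleStar (suc a″) (suc b″)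

  3<a+b : 3 < a + b
  3<a+b = +-monoʳ-≤ 3 (≤-trans (s≤s z≤n) (m≤n+m b a″))

  2+a<a+b : suc (suc a) < a + b
  2+a<a+b = subst (_≤ a + b) (+-comm a 3) (+-monoʳ-≤ a (m≤m+n 3 b″))

  x₂ y₂ : V
  x₂ = vertex 3 3<a+b
  y₂ = vertex (suc (suc a)) 2+a<a+b

  u~x₂ : T (adj S u x₂)
  u~x₂ = DSEdge⇒adj refl (toℕ-vertex 3<a+b) (u-x (s≤s (s≤s z≤n)) (s≤s (s≤s (s≤s z≤n))))

  v~y₂ : T (adj S v y₂)
  v~y₂ = DSEdge⇒adj refl (toℕ-vertex 2+a<a+b) (v-y (n≤1+n _) (<⇒≤pred 2+a<a+b))

  proper₂⇒3≤classSize : (c : V → Fin 2) → IsProper S c → ∀ i → 3 ≤ classSize S c i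
  proper₂⇒3≤classSize c proper i = by-colour-of-u (c u ≟ i)
    where
    cu≢cv : c u ≢ c v
    cu≢cv = proper u v (T-≡ .to u~v)
    cy≡cu : ∀ {y} → T (adj S v y) → c y ≡ c u
    cy≡cu v~y = proper₂-common-neighbour S {z = v} c proper v~y (adj-sym {u} {v} u~v)
    cx≡cv : ∀ {x} → T (adj S u x) → c x ≡ c v
    cx≡cv u~x = proper₂-common-neighbour S {z = u} c proper u~x u~v
    by-colour-of-u : Dec (c u ≡ i) → 3 ≤ classSize S c i
    by-colour-of-u (yes cu≡i) = 3≤count {p = λ w → ⁅ i ⁆ (c w)} {u} {y₁} {y₂}
      (distinct {i = 0} refl toℕ-y₁ (λ ()))
      (distinct {i = 0} refl (toℕ-vertex 2+a<a+b) (λ ()))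
      (distinct toℕ-y₁ (toℕ-vertex 2+a<a+b) (1+n≢n ∘ sym))
      (≡⇒⁅⁆ i (c u) cu≡i)
      (≡⇒⁅⁆ i (c y₁) (trans (cy≡cu v~y₁) cu≡i))
      (≡⇒⁅⁆ i (c y₂) (trans (cy≡cu v~y₂) cu≡i))
    by-colour-of-u (no cu≢i) = 3≤count {p = λ w → ⁅ i ⁆ (c w)} {v} {x₁} {x₂}
      (distinct {i = 1} refl toℕ-x₁ (λ ()))
      (distinct {i = 1} refl (toℕ-vertex 3<a+b) (λ ()))
      (distinct toℕ-x₁ (toℕ-vertex 3<a+b) (λ ()))
      (≡⇒⁅⁆ i (c v) cv≡i)
      (≡⇒⁅⁆ i (c x₁) (trans (cx≡cv u~x₁) cv≡i))
      (≡⇒⁅⁆ i (c x₂) (trans (cx≡cv u~x₂) cv≡i))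
      where
      cv≡i : c v ≡ i
      cv≡i = both-≢⇒≡ (cu≢cv ∘ sym) (cu≢i ∘ sym)

  ¬hasMDColoring-2 : ¬ HasMDColoring S 2
  ¬hasMDColoring-2 (c , proper , _ , majority) with majority x₁
  ... | i , majority-at-x₁ = <⇒≱ (n<1+n 2) (begin
    3                          ≤⟨ proper₂⇒3≤classSize c proper i ⟩
    classSize S c i            ≤⟨ majority-at-x₁ ⟩
    2 * nbhdClassSize S c x₁ i ≤⟨ *-monoʳ-≤ 2 (proper⇒nbhdClassSize-x₁≤1 c proper i) ⟩
    2                          ∎)
    where open ≤-Reasoning

χmd≡3 : ∀ {a b} → 3 ≤ a → 3 ≤ b → χmd≡ (doubleStar a b) 3
χmd≡3 {suc (suc (suc a″))} {suc (suc (suc b″))} (s≤s (s≤s (s≤s _))) (s≤s (s≤s (s≤s _))) =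
  hasMDColoring-3 (suc a″) (suc b″) , fewer
  where
  fewer : ∀ m → m < 3 → ¬ HasMDColoring (doubleStar (3 + a″) (3 + b″)) m
  fewer m m<3 with m<1+n⇒m<n∨m≡n m<3
  ... | inj₁ m<2  = DoubleStar.¬hasMDColoring-<2 (suc a″) (suc b″) m<2
  ... | inj₂ refl = ¬hasMDColoring-2 a″ b″

χmd≡2 : ∀ {a b} → 2 ≤ a → 2 ≤ b → a < 3 ⊎ b < 3 → χmd≡ (doubleStar a b) 2
χmd≡2 {b = suc (suc b′)} (s≤s (s≤s _)) (s≤s (s≤s _)) (inj₁ (s≤s (s≤s (s≤s z≤n)))) =
  hasMDColoring-2-a≡2 b′ , λ _ → DoubleStar.¬hasMDColoring-<2 0 b′
χmd≡2 {a = suc (suc a′)} (s≤s (s≤s _)) _ (inj₂ (s≤s (s≤s (s≤s z≤n)))) =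
  hasMDColoring-2-b≡2 a′ , λ _ → DoubleStar.¬hasMDColoring-<2 a′ 0

proposition3p3 : ∀ (a b : ℕ) → 2 ≤ a → 2 ≤ b →
    (3 ≤ a → 3 ≤ b → χmd≡ (doubleStar a b) 3) ×
    ((a < 3 ⊎ b < 3) → χmd≡ (doubleStar a b) 2)
proposition3p3 a b 2≤a 2≤b = χmd≡3 , χmd≡2 2≤a 2≤b
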